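{- Let $G$ be a $3$-rank-connected graph with $|V(G)|\ge 12$ and let $x,y$ be distinct vertices of $G$ such that $G\setminus x$ and $G\setminus y$ are weakly $3$-rank-connected. Let $A$ be a quad of $G\setminus x$ and $B$ a quad of $G\setminus y$. Then $|A\cap B|\le 2$.
   Context: Graphs are finite and simple; $G\setminus v$ is deletion. The cut-rank $\rho_G(X)$ is the $\mathrm{GF}(2)$-rank of the $X\times(V(G)-X)$ submatrix of the adjacency matrix. $G$ is $k$-rank-connected if there is no partition $(A,B)$ of $V(G)$ with $|A|,|B|>\rho_G(A)$ and $\rho_G(A)<k$; prime means $2$-rank-connected. $G$ is weakly $3$-rank-connected if it is prime and no $X\subseteq V(G)$ has $|X|\ge5$, $|V(G)-X|\ge5$, $\rho_G(X)\le2$. A quad of $G$ is a $4$-element $P\subseteq V(G)$ with $\rho_G(P)=2$ and $\rho_G(P-\{z\})=3$ for each $z\in P$. -}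

module Defs where

open import Data.Vec using (lookup)
open import Data.Bool using (Bool; true; false; _∧_; _xor_)
open import Data.Nat using (ℕ; zero; suc; _≤_; _<_)
open import Data.Fin using (Fin; zero; suc)
open import Data.Fin.Subset using (Subset; _∈_; _∉_; _⊆_; _─_; _-_; ∣_∣; ⁅_⁆)
open import Data.Product using (Σ; ∃; ∃-syntax; _×_)
open import Relation.Binary.PropositionalEquality using (_≡_)
open import Relation.Nullary using (¬_)

record Graph (n : ℕ) : Set where
  field
    adj    : Fin n → Fin n → Bool
    sym    : ∀ i j → adj i j ≡ adj j i
    irrefl : ∀ i → adj i i ≡ false
open Graph public

Σ₂ : {k : ℕ} → (Fin k → Bool) → Bool
Σ₂ {zero}  f = false
Σ₂ {suc k} f = f zero xor Σ₂ (λ t → f (suc t))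

-- We work with induced subgraphs G[S] of G (S ⊆ V(G)); G \ x is G[V(G) - {x}].
-- Entry (i , j) of the X × (S - X) submatrix of the adjacency matrix of G[S]
-- (for j outside S - X the column is absent; we pad with 0).
cutEntry : {n : ℕ} → Graph n → Subset n → Subset n → Fin n → Fin n → Bool
cutEntry G S X i j = lookup (S ─ X) j ∧ adj G i j

CutRankLe : {n : ℕ} → Graph n → Subset n → Subset n → ℕ → Set
CutRankLe {n} G S X k =
  Σ (Fin k → Fin n → Bool) λ v →
    ∀ i → i ∈ X → Σ (Fin k → Bool) λ c →
      ∀ j → cutEntry G S X i j ≡ Σ₂ (λ t → c t ∧ v t j)

CutRank : {n : ℕ} → Graph n → Subset n → Subset n → ℕ → Set
CutRank G S X r = CutRankLe G S X r × (∀ m → CutRankLe G S X m → r ≤ m)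

RankConnected : {n : ℕ} → ℕ → Graph n → Subset n → Set
RankConnected k G S =
  ¬ (∃[ A ] ∃[ r ] (A ⊆ S × CutRank G S A r × r < ∣ A ∣ × r < ∣ S ─ A ∣ × r < k))

Prime : {n : ℕ} → Graph n → Subset n → Set
Prime G S = RankConnected 2 G S

WeaklyThreeRankConnected : {n : ℕ} → Graph n → Subset n → Set
WeaklyThreeRankConnected G S =
  Prime G S ×
  ¬ (∃[ X ] ∃[ r ] (X ⊆ S × 5 ≤ ∣ X ∣ × 5 ≤ ∣ S ─ X ∣ × CutRank G S X r × r ≤ 2))

Quad : {n : ℕ} → Graph n → Subset n → Subset n → Set
Quad G S P =
  P ⊆ S × ∣ P ∣ ≡ 4 × CutRank G S P 2 × (∀ z → z ∈ P → CutRank G S (P - z) 3)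

{-# OPTIONS --safe #-}
-- Rows of the adjacency matrix are vectors over GF(2); suppose |A ∩ B| ≥ 3.
-- If A = B, the rows of A off A ∪ {x, y} either lie on one line, and then ρ(A ∪ {x}) ≤ 2 in
-- G \ y, or contain two independent rows; these determine every row of A both on (V - x) - A
-- and on (V - y) - A, so ρ_G(A) ≤ 2.
-- If A ∩ B = T has three elements, write A = T + a and B = T + b. The rows of T satisfy a
-- linear relation off A and one off B. The two relations differ, since B - b = T has cut-rank 3
-- in G \ y, so off A ∪ B ∪ {x, y} the rows of T lie on one line, and then so do the rows of a
-- and b. Unless b = x this gives ρ(A ∪ B) ≤ 2 in G \ x, and symmetrically unless a = y; if
-- b = x and a = y, the row of x lies in the span of the rows of A off A ∪ {x}, so ρ_G(A ∪ B) ≤ 2.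
-- As |A ∪ B| = 5 and |V| ≥ 12, each bound is a separation the hypotheses forbid.
module Submission where

open import Defs hiding (sym)
open import Data.Bool using (Bool; true; false; _∧_; _∨_; _xor_; not; if_then_else_)
import Data.Bool.Properties as BoolP
open import Data.Nat using (ℕ; zero; suc; _+_; _≤_; _<_; _≤′_; ≤′-refl; ≤′-step; z≤n; s≤s; _≤?_)
import Data.Nat.Properties as ℕP
open import Data.Vec using (Vec; []; _∷_; lookup; map; here; there)
open import Data.Vec.Properties using ([]=⇒lookup; lookup⇒[]=; lookup-zipWith; lookup-replicate)
open import Data.Fin.Subset using (Subset; _∈_; _∉_; _⊆_; ⊤; ⁅_⁆; _∩_; _∪_; _─_; _-_; ∣_∣)
import Data.Fin.Subset.Properties as SubsetP
open import Data.Fin using (Fin; zero; suc)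
import Data.Fin.Properties as FinP
open FinP using (_≟_)
open import Data.Product using (Σ; ∃; _×_; _,_; proj₁; proj₂)
open import Data.Sum using (_⊎_; inj₁; inj₂; [_,_]′)
open import Data.Empty using (⊥; ⊥-elim)
open import Function using (_∘_)
open import Relation.Binary.PropositionalEquality using (_≡_; _≢_; refl; sym; trans; cong; cong₂; subst; module ≡-Reasoning)
open import Relation.Nullary using (¬_; Dec; yes; no; map′)
open import Relation.Nullary.Decidable using (True; toWitness; _×-dec_; _⊎-dec_; _→-dec_; ¬?; decidable-stable)

BoolFun : ℕ → Set
BoolFun zero    = Bool
BoolFun (suc k) = Bool → BoolFun k

Tautology : (k : ℕ) → BoolFun k → Set
Tautology zero    b = b ≡ true
Tautology (suc k) f = ∀ b → Tautology k (f b)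

tautology? : (k : ℕ) (f : BoolFun k) → Dec (Tautology k f)
tautology? zero    b = b BoolP.≟ true
tautology? (suc k) f =
  map′ (λ { (t , u) true → t ; (t , u) false → u }) (λ h → h true , h false)
       (tautology? k (f true) ×-dec tautology? k (f false))

truth-table : (k : ℕ) {f : BoolFun k} {_ : True (tautology? k f)} → Tautology k f
truth-table k {_} {t} = toWitness t

infixr 3 _⇒_
infix  4 _==_

_⇒_ : Bool → Bool → Bool
a ⇒ b = not a ∨ b

_==_ : Bool → Bool → Bool
a == b = not (a xor b)

modus-ponens : ∀ {a b} → (a ⇒ b) ≡ true → a ≡ true → b ≡ true
modus-ponens {true} a⇒b refl = a⇒b

==⇒≡ : ∀ {a b} → (a == b) ≡ true → a ≡ b
==⇒≡ {true}  {true}  _ = refl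
==⇒≡ {false} {false} _ = refl

≡⇒== : ∀ {a b} → a ≡ b → (a == b) ≡ true
≡⇒== {true}  refl = refl
≡⇒== {false} refl = refl

∧-true : ∀ {a b} → a ≡ true → b ≡ true → a ∧ b ≡ true
∧-true refl refl = refl

∧-trueˡ : ∀ {a b} → a ∧ b ≡ true → a ≡ true
∧-trueˡ {true} _ = refl

∧-trueʳ : ∀ {a b} → a ∧ b ≡ true → b ≡ true
∧-trueʳ {true} ab = ab

∨-false : ∀ {a b} → a ∨ b ≡ false → a ≡ false × b ≡ false
∨-false {false} b≡false = refl , b≡false

∨-true⇒⊎ : ∀ {a b} → a ∨ b ≡ true → a ≡ true ⊎ b ≡ true
∨-true⇒⊎ {true}  _ = inj₁ refl
∨-true⇒⊎ {false} b = inj₂ b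

xor≡false⇒≡ : ∀ {a b} → a xor b ≡ false → a ≡ b
xor≡false⇒≡ {true}  {true}  _ = refl
xor≡false⇒≡ {false} {false} _ = refl

-- Vectors over GF(2)

-- Vectors are compared only on the coordinates selected by a mask M.
Bits : ℕ → Set
Bits n = Fin n → Bool

module _ {n : ℕ} where

  infix 4 _⊆ᵇ_

  _⊆ᵇ_ : Bits n → Bits n → Set
  M ⊆ᵇ N = ∀ j → M j ≡ true → N j ≡ true

  InSpan₁ : (M u w : Bits n) → Set
  InSpan₁ M u w = Σ Bool λ f → ∀ j → M j ≡ true → w j ≡ f ∧ u j

  InSpan₂ : (M p q w : Bits n) → Set
  InSpan₂ M p q w = Σ Bool λ e₁ → Σ Bool λ e₂ → ∀ j → M j ≡ true → w j ≡ e₁ ∧ p j xor e₂ ∧ q j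

  VanishesOn : (M r : Bits n) → Set
  VanishesOn M r = ∀ j → M j ≡ true → r j ≡ false

  Dependent₂ : (M r s : Bits n) → Set
  Dependent₂ M r s = VanishesOn M r ⊎ VanishesOn M s ⊎ (∀ j → M j ≡ true → r j ≡ s j)

  ⊆ᵇ-trans : ∀ {M N O} → M ⊆ᵇ N → N ⊆ᵇ O → M ⊆ᵇ O
  ⊆ᵇ-trans M⊆N N⊆O j j∈M = N⊆O j (M⊆N j j∈M)

  inSpan₂-mono : ∀ {M N p q w} → N ⊆ᵇ M → InSpan₂ M p q w → InSpan₂ N p q w
  inSpan₂-mono N⊆M (e₁ , e₂ , h) = e₁ , e₂ , λ j m → h j (N⊆M j m)

  dependent₂-mono : ∀ {M N r s} → N ⊆ᵇ M → Dependent₂ M r s → Dependent₂ N r s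
  dependent₂-mono N⊆M (inj₁ h)        = inj₁ λ j m → h j (N⊆M j m)
  dependent₂-mono N⊆M (inj₂ (inj₁ h)) = inj₂ (inj₁ λ j m → h j (N⊆M j m))
  dependent₂-mono N⊆M (inj₂ (inj₂ h)) = inj₂ (inj₂ λ j m → h j (N⊆M j m))

  vanishesOn? : ∀ M r → Dec (VanishesOn M r)
  vanishesOn? M r = FinP.all? λ j → M j BoolP.≟ true →-dec r j BoolP.≟ false

  dependent₂? : ∀ M r s → Dec (Dependent₂ M r s)
  dependent₂? M r s =
    vanishesOn? M r ⊎-dec vanishesOn? M s ⊎-dec FinP.all? λ j → M j BoolP.≟ true →-dec r j BoolP.≟ s j

  inSpan₁-trans : ∀ {M r s w u} → InSpan₂ M r s w → InSpan₁ M u r → InSpan₁ M u s → InSpan₁ M u w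
  inSpan₁-trans {u = u} (e₁ , e₂ , hw) (f , hr) (g , hs) =
    e₁ ∧ f xor e₂ ∧ g , λ j m →
      trans (hw j m) (trans (cong₂ (λ a b → e₁ ∧ a xor e₂ ∧ b) (hr j m) (hs j m))
                            (==⇒≡ (collect e₁ e₂ f g (u j))))
    where
    collect : Tautology 5 λ e₁ e₂ f g x → e₁ ∧ (f ∧ x) xor e₂ ∧ (g ∧ x) == (e₁ ∧ f xor e₂ ∧ g) ∧ x
    collect = truth-table 5

  inSpan₂-trans : ∀ {M r s w p q} → InSpan₂ M r s w → InSpan₂ M p q r → InSpan₂ M p q s → InSpan₂ M p q w
  inSpan₂-trans {p = p} {q} (e₁ , e₂ , hw) (a₁ , a₂ , hr) (b₁ , b₂ , hs) =
    e₁ ∧ a₁ xor e₂ ∧ b₁ , e₁ ∧ a₂ xor e₂ ∧ b₂ , λ j m →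
      trans (hw j m) (trans (cong₂ (λ a b → e₁ ∧ a xor e₂ ∧ b) (hr j m) (hs j m))
                            (==⇒≡ (collect e₁ e₂ a₁ a₂ b₁ b₂ (p j) (q j))))
    where
    collect : Tautology 8 λ e₁ e₂ a₁ a₂ b₁ b₂ x y →
      e₁ ∧ (a₁ ∧ x xor a₂ ∧ y) xor e₂ ∧ (b₁ ∧ x xor b₂ ∧ y) == (e₁ ∧ a₁ xor e₂ ∧ b₁) ∧ x xor (e₁ ∧ a₂ xor e₂ ∧ b₂) ∧ y
    collect = truth-table 8

  dependent₂-of-combination : ∀ {M r s} d₁ d₂ → d₁ ∨ d₂ ≡ true →
    (∀ j → M j ≡ true → d₁ ∧ r j xor d₂ ∧ s j ≡ false) → Dependent₂ M r s
  dependent₂-of-combination true  false _ h = inj₁ λ j m → trans (sym (BoolP.xor-identityʳ _)) (h j m)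
  dependent₂-of-combination false true  _ h = inj₂ (inj₁ h)
  dependent₂-of-combination true  true  _ h = inj₂ (inj₂ λ j m → xor≡false⇒≡ (h j m))
  dependent₂-of-combination false false () _

  span₂-coefficients-unique : ∀ {M r s w : Bits n} e₁ e₂ f₁ f₂ → ¬ Dependent₂ M r s →
    (∀ j → M j ≡ true → w j ≡ e₁ ∧ r j xor e₂ ∧ s j) →
    (∀ j → M j ≡ true → w j ≡ f₁ ∧ r j xor f₂ ∧ s j) → e₁ ≡ f₁ × e₂ ≡ f₂
  span₂-coefficients-unique {r = r} {s} e₁ e₂ f₁ f₂ indep he hf with (e₁ xor f₁) ∨ (e₂ xor f₂) in differ
  ... | true  = ⊥-elim (indep (dependent₂-of-combination (e₁ xor f₁) (e₂ xor f₂) differ λ j m →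
                  ==⇒≡ (modus-ponens (difference e₁ e₂ f₁ f₂ (r j) (s j)) (≡⇒== (trans (sym (he j m)) (hf j m))))))
    where
    difference : Tautology 6 λ e₁ e₂ f₁ f₂ x y →
      (e₁ ∧ x xor e₂ ∧ y == f₁ ∧ x xor f₂ ∧ y) ⇒ ((e₁ xor f₁) ∧ x xor (e₂ xor f₂) ∧ y == false)
    difference = truth-table 6
  ... | false with ∨-false differ
  ...   | same₁ , same₂ = xor≡false⇒≡ same₁ , xor≡false⇒≡ same₂

  inSpan₂-∪ : ∀ {M N r s w : Bits n} → ¬ Dependent₂ (λ j → M j ∧ N j) r s →
    InSpan₂ M r s w → InSpan₂ N r s w → InSpan₂ (λ j → M j ∨ N j) r s w
  inSpan₂-∪ {M} {N} {r} {s} {w} indep (e₁ , e₂ , hM) (f₁ , f₂ , hN)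
    with span₂-coefficients-unique e₁ e₂ f₁ f₂ indep (λ j m → hM j (∧-trueˡ m)) (λ j m → hN j (∧-trueʳ {M j} m))
  ... | refl , refl = e₁ , e₂ , pointwise
    where
    pointwise : ∀ j → M j ∨ N j ≡ true → w j ≡ e₁ ∧ r j xor e₂ ∧ s j
    pointwise j j∈M∪N with M j in j∈M
    ... | true  = hM j j∈M
    ... | false = hN j j∈M∪N

Bool³ : Set
Bool³ = Bool × Bool × Bool

nonzero : Bool³ → Bool
nonzero (e₁ , e₂ , e₃) = e₁ ∨ e₂ ∨ e₃

combination : Bool³ → Bool³ → Bool
combination (e₁ , e₂ , e₃) (a , b , c) = e₁ ∧ a xor e₂ ∧ b xor e₃ ∧ c

_==³_ : Bool³ → Bool³ → Bool
(a₁ , a₂ , a₃) ==³ (b₁ , b₂ , b₃) = (a₁ == b₁) ∧ (a₂ == b₂) ∧ (a₃ == b₃)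

≢⇒not-==³ : (c d : Bool³) → c ≢ d → not (c ==³ d) ≡ true
≢⇒not-==³ c@(c₁ , c₂ , c₃) d@(d₁ , d₂ , d₃) c≢d with c ==³ d in same
... | false = refl
... | true  = ⊥-elim (c≢d (cong₂ _,_ (==⇒≡ (∧-trueˡ same))
                        (cong₂ _,_ (==⇒≡ (∧-trueˡ (∧-trueʳ {c₁ == d₁} same)))
                                   (==⇒≡ (∧-trueʳ {c₂ == d₂} (∧-trueʳ {c₁ == d₁} same))))))

_×³_ : Bool³ → Bool³ → Bool³
(c₁ , c₂ , c₃) ×³ (d₁ , d₂ , d₃) = c₂ ∧ d₃ xor c₃ ∧ d₂ , c₃ ∧ d₁ xor c₁ ∧ d₃ , c₁ ∧ d₂ xor c₂ ∧ d₁

firstNonzero : Bool³ → Bool³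
firstNonzero (g₁ , g₂ , g₃) = g₁ , not g₁ ∧ g₂ , not g₁ ∧ not g₂ ∧ g₃

at₃ : ∀ {n} → (Fin 3 → Bits n) → Fin n → Bool³
at₃ u j = u zero j , u (suc zero) j , u (suc (suc zero)) j

record Relation₃ {n : ℕ} (M : Bits n) (u : Fin 3 → Bits n) : Set where
  constructor relation
  field
    coefficients : Bool³
    nontrivial   : nonzero coefficients ≡ true
    vanishes     : ∀ j → M j ≡ true → combination coefficients (at₃ u j) ≡ false

-- A nonzero vector in the left kernel of the 3 × 2 matrix with rows (aᵢ , bᵢ), found by search.
leftKernel : (a₁ b₁ a₂ b₂ a₃ b₃ : Bool) → Bool³
leftKernel a₁ b₁ a₂ b₂ a₃ b₃ =
  if kills (true , false , false) then (true , false , false) else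
  if kills (false , true , false) then (false , true , false) else
  if kills (false , false , true) then (false , false , true) else
  if kills (true , true , false)  then (true , true , false)  else
  if kills (true , false , true)  then (true , false , true)  else
  if kills (false , true , true)  then (false , true , true)  else (true , true , true)
  where
  kills : Bool³ → Bool
  kills e = not (combination e (a₁ , a₂ , a₃)) ∧ not (combination e (b₁ , b₂ , b₃))

module _ {n : ℕ} {M : Bits n} where

  span₂-left : ∀ {p q} → InSpan₂ M p q p
  span₂-left = true , false , λ j _ → sym (BoolP.xor-identityʳ _)

  span₂-right : ∀ {p q} → InSpan₂ M p q q
  span₂-right = false , true , λ j _ → refl

  relation₃-mono : ∀ {N u} → N ⊆ᵇ M → Relation₃ M u → Relation₃ N u
  relation₃-mono N⊆M r = relation (coefficients r) (nontrivial r) λ j j∈N → vanishes r j (N⊆M j j∈N)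
    where open Relation₃

  relation-of-three-in-span₂ : ∀ {p q u} → (∀ l → InSpan₂ M p q (u l)) → Relation₃ M u
  relation-of-three-in-span₂ {p} {q} span with span zero | span (suc zero) | span (suc (suc zero))
  ... | a₁ , b₁ , h₁ | a₂ , b₂ , h₂ | a₃ , b₃ , h₃ =
    relation e (kernel-nonzero a₁ b₁ a₂ b₂ a₃ b₃) λ j m →
      trans (cong (combination e) (cong₂ _,_ (h₁ j m) (cong₂ _,_ (h₂ j m) (h₃ j m))))
            (==⇒≡ (kernel-kills a₁ b₁ a₂ b₂ a₃ b₃ (p j) (q j)))
    where
    e : Bool³
    e = leftKernel a₁ b₁ a₂ b₂ a₃ b₃
    kernel-nonzero : Tautology 6 λ a₁ b₁ a₂ b₂ a₃ b₃ → nonzero (leftKernel a₁ b₁ a₂ b₂ a₃ b₃)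
    kernel-nonzero = truth-table 6
    kernel-kills : Tautology 8 λ a₁ b₁ a₂ b₂ a₃ b₃ x y →
      combination (leftKernel a₁ b₁ a₂ b₂ a₃ b₃) (a₁ ∧ x xor b₁ ∧ y , a₂ ∧ x xor b₂ ∧ y , a₃ ∧ x xor b₃ ∧ y) == false
    kernel-kills = truth-table 8

  span₂-of-relation : ∀ {u} → Relation₃ M u → Σ (Bits n) λ p → Σ (Bits n) λ q → ∀ l → InSpan₂ M p q (u l)
  span₂-of-relation {u} (relation (true , e₂ , e₃) _ h) = u (suc zero) , u (suc (suc zero)) , λ
    { zero → e₂ , e₃ , λ j m → xor≡false⇒≡ (h j m) ; (suc zero) → span₂-left ; (suc (suc zero)) → span₂-right }
  span₂-of-relation {u} (relation (false , true , e₃) _ h) = u zero , u (suc (suc zero)) , λ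
    { zero → span₂-left ; (suc zero) → false , e₃ , λ j m → xor≡false⇒≡ (h j m) ; (suc (suc zero)) → span₂-right }
  span₂-of-relation {u} (relation (false , false , true) _ h) = u zero , u (suc zero) , λ
    { zero → span₂-left ; (suc zero) → span₂-right ; (suc (suc zero)) → false , false , h }
  span₂-of-relation (relation (false , false , false) () _)

  -- Over GF(2) distinct nonzero c and d are independent, so at₃ u j, being orthogonal to both,
  -- is a multiple of c ×³ d; the factor is read off at the first nonzero coordinate.
  span₁-of-two-relations : ∀ {u} (c d : Relation₃ M u) →
    Relation₃.coefficients c ≢ Relation₃.coefficients d → Σ (Bits n) λ w → ∀ l → InSpan₁ M w (u l)
  span₁-of-two-relations {u} (relation c@(c₁ , c₂ , c₃) c≠0 hc) (relation d@(d₁ , d₂ , d₃) d≠0 hd) c≢d =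
    (λ j → combination (firstNonzero g) (at₃ u j)) , λ
      { zero             → proj₁ g , λ j m → ==⇒≡ (∧-trueˡ (multiple j m))
      ; (suc zero)       → proj₁ (proj₂ g) , λ j m → ==⇒≡ (∧-trueˡ (∧-trueʳ {u zero j == _} (multiple j m)))
      ; (suc (suc zero)) → proj₂ (proj₂ g) , λ j m →
                             ==⇒≡ (∧-trueʳ {u (suc zero) j == _} (∧-trueʳ {u zero j == _} (multiple j m)))
      }
    where
    g : Bool³
    g = c ×³ d
    collinear : Tautology 9 λ c₁ c₂ c₃ d₁ d₂ d₃ x y z →
      let c = (c₁ , c₂ , c₃) ; d = (d₁ , d₂ , d₃) ; g = c ×³ d
          w = combination (firstNonzero g) (x , y , z) in
      nonzero c ∧ nonzero d ∧ not (c ==³ d) ∧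
        (combination c (x , y , z) == false) ∧ (combination d (x , y , z) == false)
      ⇒ (x == proj₁ g ∧ w) ∧ (y == proj₁ (proj₂ g) ∧ w) ∧ (z == proj₂ (proj₂ g) ∧ w)
    collinear = truth-table 9
    multiple : ∀ j → M j ≡ true →
      (u zero j == proj₁ g ∧ combination (firstNonzero g) (at₃ u j)) ∧
      (u (suc zero) j == proj₁ (proj₂ g) ∧ combination (firstNonzero g) (at₃ u j)) ∧
      (u (suc (suc zero)) j == proj₂ (proj₂ g) ∧ combination (firstNonzero g) (at₃ u j)) ≡ true
    multiple j m = modus-ponens (collinear c₁ c₂ c₃ d₁ d₂ d₃ (u zero j) (u (suc zero) j) (u (suc (suc zero)) j))
      (∧-true c≠0 (∧-true d≠0 (∧-true (≢⇒not-==³ c d c≢d) (∧-true (≡⇒== (hc j m)) (≡⇒== (hd j m))))))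

  span₂-of-independent : ∀ {p q r s w} → ¬ Dependent₂ M r s →
    InSpan₂ M p q r → InSpan₂ M p q s → InSpan₂ M p q w → InSpan₂ M r s w
  span₂-of-independent {r = r} {s} {w} indep hr hs hw
    with relation-of-three-in-span₂ {u = λ { zero → r ; (suc zero) → s ; (suc (suc zero)) → w }}
           (λ { zero → hr ; (suc zero) → hs ; (suc (suc zero)) → hw })
  ... | relation (e₁ , e₂ , true) _ h =
    e₁ , e₂ , λ j m → sym (xor≡false⇒≡ (trans (BoolP.xor-assoc (e₁ ∧ r j) (e₂ ∧ s j) (w j)) (h j m)))
  ... | relation (e₁ , e₂ , false) e≠0 h =
    ⊥-elim (indep (dependent₂-of-combination e₁ e₂
      (trans (cong (e₁ ∨_) (sym (BoolP.∨-identityʳ e₂))) e≠0)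
      λ j m → trans (cong (e₁ ∧ r j xor_) (sym (BoolP.xor-identityʳ (e₂ ∧ s j)))) (h j m)))

  single-or-independent : ∀ {m} (R : Fin m → Bits n) →
    (Σ (Bits n) λ u → ∀ i → InSpan₁ M u (R i)) ⊎ (Σ (Fin m) λ i → Σ (Fin m) λ k → ¬ Dependent₂ M (R i) (R k))
  single-or-independent {m} R with FinP.all? (λ i → FinP.all? λ k → dependent₂? M (R i) (R k))
  ... | no ¬all with FinP.¬∀⟶∃¬ m _ (λ i → FinP.all? λ k → dependent₂? M (R i) (R k)) ¬all
  ...   | i , ¬all-k with FinP.¬∀⟶∃¬ m _ (λ k → dependent₂? M (R i) (R k)) ¬all-k
  ...     | k , indep = inj₂ (i , k , indep)
  single-or-independent R | yes dep with FinP.any? (λ i → ¬? (vanishesOn? M (R i)))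
  ... | yes (i , R≠0) = inj₁ (R i , λ k → multiple k (dep i k))
    where
    multiple : ∀ k → Dependent₂ M (R i) (R k) → InSpan₁ M (R i) (R k)
    multiple k (inj₁ R≡0)        = ⊥-elim (R≠0 R≡0)
    multiple k (inj₂ (inj₁ h))   = false , h
    multiple k (inj₂ (inj₂ h))   = true , λ j m → sym (h j m)
  ... | no all-zero = inj₁ ((λ _ → false) , λ k →
          false , decidable-stable (vanishesOn? M (R k)) λ R≠0 → all-zero (k , R≠0))

-- Subsets and their characteristic vectors

module _ {n : ℕ} where

  infix 4 _≐_

  record _≐_ (p : Subset n) (f : Bits n) : Set where
    constructor mk≐
    field lookup-≐ : ∀ j → lookup p j ≡ f j
  open _≐_ public

  ≐-lookup : (p : Subset n) → p ≐ lookup p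
  ≐-lookup p = mk≐ λ _ → refl

  ≐-⊤ : ⊤ ≐ λ _ → true
  ≐-⊤ = mk≐ λ j → lookup-replicate j true

  ≐-∩ : ∀ {p q f g} → p ≐ f → q ≐ g → p ∩ q ≐ λ j → f j ∧ g j
  ≐-∩ {p} {q} (mk≐ p≐f) (mk≐ q≐g) = mk≐ λ j → trans (lookup-zipWith _∧_ j p q) (cong₂ _∧_ (p≐f j) (q≐g j))

  ≐-∪ : ∀ {p q f g} → p ≐ f → q ≐ g → p ∪ q ≐ λ j → f j ∨ g j
  ≐-∪ {p} {q} (mk≐ p≐f) (mk≐ q≐g) = mk≐ λ j → trans (lookup-zipWith _∨_ j p q) (cong₂ _∨_ (p≐f j) (q≐g j))

  ≐-─ : ∀ {p q f g} → p ≐ f → q ≐ g → p ─ q ≐ λ j → f j ∧ not (g j)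
  ≐-─ {p} {q} (mk≐ p≐f) (mk≐ q≐g) = mk≐ λ j → trans (lookup-─ p q j) (cong₂ (λ u v → u ∧ not v) (p≐f j) (q≐g j))
    where
    lookup-─ : ∀ {m} (p q : Subset m) j → lookup (p ─ q) j ≡ lookup p j ∧ not (lookup q j)
    lookup-─ (s ∷ p) (true  ∷ q) zero    = sym (BoolP.∧-zeroʳ s)
    lookup-─ (s ∷ p) (false ∷ q) zero    = sym (BoolP.∧-identityʳ s)
    lookup-─ (_ ∷ p) (_     ∷ q) (suc j) = lookup-─ p q j

  ≐⇒⊆ᵇ : ∀ {p f} → p ≐ f → lookup p ⊆ᵇ f
  ≐⇒⊆ᵇ (mk≐ p≐f) j j∈p = trans (sym (p≐f j)) j∈p

  ≐⇒⊇ᵇ : ∀ {p f} → p ≐ f → f ⊆ᵇ lookup p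
  ≐⇒⊇ᵇ (mk≐ p≐f) j j∈f = trans (p≐f j) j∈f

  ∈⇒lookup : ∀ {i} {p : Subset n} → i ∈ p → lookup p i ≡ true
  ∈⇒lookup = []=⇒lookup

  lookup⇒∈ : ∀ {i} {p : Subset n} → lookup p i ≡ true → i ∈ p
  lookup⇒∈ {i} {p} = lookup⇒[]= i p

  ∉⇒lookup : ∀ {i} {p : Subset n} → i ∉ p → lookup p i ≡ false
  ∉⇒lookup i∉p = BoolP.¬-not (i∉p ∘ lookup⇒∈)

  lookup-⁅⁆-self : (z : Fin n) → lookup ⁅ z ⁆ z ≡ true
  lookup-⁅⁆-self z = ∈⇒lookup (SubsetP.x∈⁅x⁆ z)

  lookup-⁅⁆⇒≡ : ∀ {z j} → lookup ⁅ z ⁆ j ≡ true → j ≡ z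
  lookup-⁅⁆⇒≡ {z} j∈⁅z⁆ = SubsetP.x∈⁅y⁆⇒x≡y z (lookup⇒∈ j∈⁅z⁆)

  ≐∨⇒⊆ : ∀ {p q : Subset n} {f : Bits n} → p ≐ (λ j → lookup q j ∨ f j) → q ⊆ p
  ≐∨⇒⊆ {f = f} p≐ {i} i∈q = lookup⇒∈ (≐⇒⊇ᵇ p≐ i (cong (_∨ f i) (∈⇒lookup i∈q)))

  ≐∨⁅⁆⇒∈ : ∀ {p : Subset n} {f : Bits n} {z} → p ≐ (λ j → f j ∨ lookup ⁅ z ⁆ j) → z ∈ p
  ≐∨⁅⁆⇒∈ {f = f} {z} p≐ = lookup⇒∈ (≐⇒⊇ᵇ p≐ z (trans (cong (f z ∨_) (lookup-⁅⁆-self z)) (BoolP.∨-zeroʳ _)))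

  x∉p-x : ∀ {p : Subset n} {x} → x ∉ p - x
  x∉p-x {p} {x} x∈p-x with trans (sym (∈⇒lookup x∈p-x))
    (trans (lookup-≐ (≐-─ (≐-lookup p) (≐-lookup ⁅ x ⁆)) x)
           (trans (cong (λ b → lookup p x ∧ not b) (lookup-⁅⁆-self x)) (BoolP.∧-zeroʳ _)))
  ... | ()

  ⊆ᵇ⇒⊆ : ∀ {p q : Subset n} → lookup p ⊆ᵇ lookup q → p ⊆ q
  ⊆ᵇ⇒⊆ p⊆q i∈p = lookup⇒∈ (p⊆q _ (∈⇒lookup i∈p))

  disjoint-⁅⁆ : ∀ {p : Subset n} {z} → z ∉ p → ∀ j → not (lookup p j ∧ lookup ⁅ z ⁆ j) ≡ true
  disjoint-⁅⁆ {p} {z} z∉p j with lookup ⁅ z ⁆ j in j∈⁅z⁆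
  ... | false = cong not (BoolP.∧-zeroʳ (lookup p j))
  ... | true  = cong not (trans (BoolP.∧-identityʳ (lookup p j))
                              (subst (λ i → lookup p i ≡ false) (sym (lookup-⁅⁆⇒≡ j∈⁅z⁆)) (∉⇒lookup z∉p)))

  inSpan₂-insert : ∀ {N : Subset n} {M u w} (z : Fin n) → lookup (N - z) ⊆ᵇ M →
    InSpan₁ M u w → InSpan₂ (lookup N) (λ j → not (lookup ⁅ z ⁆ j) ∧ u j) (lookup ⁅ z ⁆) w
  inSpan₂-insert {N} {M} {u} {w} z N-z⊆M (f , h) = f , w z , pointwise
    where
    pointwise : ∀ j → lookup N j ≡ true → w j ≡ f ∧ (not (lookup ⁅ z ⁆ j) ∧ u j) xor w z ∧ lookup ⁅ z ⁆ j
    pointwise j j∈N with lookup ⁅ z ⁆ j in j∈⁅z⁆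
    ... | true  = trans (cong w (lookup-⁅⁆⇒≡ j∈⁅z⁆))
                        (sym (cong₂ _xor_ (BoolP.∧-zeroʳ f) (BoolP.∧-identityʳ (w z))))
    ... | false = trans (h j (N-z⊆M j (≐⇒⊇ᵇ (≐-─ (≐-lookup N) (≐-lookup ⁅ z ⁆)) j
                                        (trans (cong (λ b → lookup N j ∧ not b) j∈⁅z⁆) (trans (BoolP.∧-identityʳ _) j∈N)))))
                        (sym (trans (cong (f ∧ u j xor_) (BoolP.∧-zeroʳ (w z))) (BoolP.xor-identityʳ _)))

∣p─q∣+∣q∣≡∣p∣ : ∀ {n} (p q : Subset n) → q ⊆ p → ∣ p ─ q ∣ + ∣ q ∣ ≡ ∣ p ∣
∣p─q∣+∣q∣≡∣p∣ []          []          _   = refl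
∣p─q∣+∣q∣≡∣p∣ (true  ∷ p) (true  ∷ q) q⊆p =
  trans (ℕP.+-suc ∣ p ─ q ∣ ∣ q ∣) (cong suc (∣p─q∣+∣q∣≡∣p∣ p q (SubsetP.drop-∷-⊆ q⊆p)))
∣p─q∣+∣q∣≡∣p∣ (true  ∷ p) (false ∷ q) q⊆p = cong suc (∣p─q∣+∣q∣≡∣p∣ p q (SubsetP.drop-∷-⊆ q⊆p))
∣p─q∣+∣q∣≡∣p∣ (false ∷ p) (true  ∷ q) q⊆p with q⊆p here
... | ()
∣p─q∣+∣q∣≡∣p∣ (false ∷ p) (false ∷ q) q⊆p = ∣p─q∣+∣q∣≡∣p∣ p q (SubsetP.drop-∷-⊆ q⊆p)

∣p─q∣+∣p∩q∣≡∣p∣ : ∀ {n} (p q : Subset n) → ∣ p ─ q ∣ + ∣ p ∩ q ∣ ≡ ∣ p ∣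
∣p─q∣+∣p∩q∣≡∣p∣ []          []          = refl
∣p─q∣+∣p∩q∣≡∣p∣ (true  ∷ p) (true  ∷ q) = trans (ℕP.+-suc ∣ p ─ q ∣ ∣ p ∩ q ∣) (cong suc (∣p─q∣+∣p∩q∣≡∣p∣ p q))
∣p─q∣+∣p∩q∣≡∣p∣ (true  ∷ p) (false ∷ q) = cong suc (∣p─q∣+∣p∩q∣≡∣p∣ p q)
∣p─q∣+∣p∩q∣≡∣p∣ (false ∷ p) (true  ∷ q) = ∣p─q∣+∣p∩q∣≡∣p∣ p q
∣p─q∣+∣p∩q∣≡∣p∣ (false ∷ p) (false ∷ q) = ∣p─q∣+∣p∩q∣≡∣p∣ p q

∣p∪q∣+∣p∩q∣≡∣p∣+∣q∣ : ∀ {n} (p q : Subset n) → ∣ p ∪ q ∣ + ∣ p ∩ q ∣ ≡ ∣ p ∣ + ∣ q ∣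
∣p∪q∣+∣p∩q∣≡∣p∣+∣q∣ []          []          = refl
∣p∪q∣+∣p∩q∣≡∣p∣+∣q∣ (true  ∷ p) (true  ∷ q) = cong suc (begin
  ∣ p ∪ q ∣ + suc ∣ p ∩ q ∣   ≡⟨ ℕP.+-suc ∣ p ∪ q ∣ ∣ p ∩ q ∣ ⟩
  suc (∣ p ∪ q ∣ + ∣ p ∩ q ∣) ≡⟨ cong suc (∣p∪q∣+∣p∩q∣≡∣p∣+∣q∣ p q) ⟩
  suc (∣ p ∣ + ∣ q ∣)         ≡⟨ ℕP.+-suc ∣ p ∣ ∣ q ∣ ⟨
  ∣ p ∣ + suc ∣ q ∣           ∎)
  where open ≡-Reasoning
∣p∪q∣+∣p∩q∣≡∣p∣+∣q∣ (true  ∷ p) (false ∷ q) = cong suc (∣p∪q∣+∣p∩q∣≡∣p∣+∣q∣ p q)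
∣p∪q∣+∣p∩q∣≡∣p∣+∣q∣ (false ∷ p) (true  ∷ q) =
  trans (cong suc (∣p∪q∣+∣p∩q∣≡∣p∣+∣q∣ p q)) (sym (ℕP.+-suc ∣ p ∣ ∣ q ∣))
∣p∪q∣+∣p∩q∣≡∣p∣+∣q∣ (false ∷ p) (false ∷ q) = ∣p∪q∣+∣p∩q∣≡∣p∣+∣q∣ p q

∣p∪⁅x⁆∣≡1+∣p∣ : ∀ {n} (p : Subset n) x → x ∉ p → ∣ p ∪ ⁅ x ⁆ ∣ ≡ suc ∣ p ∣
∣p∪⁅x⁆∣≡1+∣p∣ (true  ∷ p) zero    x∉p = ⊥-elim (x∉p here)
∣p∪⁅x⁆∣≡1+∣p∣ (false ∷ p) zero    _   = cong (suc ∘ ∣_∣) (SubsetP.∪-identityʳ p)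
∣p∪⁅x⁆∣≡1+∣p∣ (true  ∷ p) (suc x) x∉p = cong suc (∣p∪⁅x⁆∣≡1+∣p∣ p x (x∉p ∘ there))
∣p∪⁅x⁆∣≡1+∣p∣ (false ∷ p) (suc x) x∉p = ∣p∪⁅x⁆∣≡1+∣p∣ p x (x∉p ∘ there)

1+∣⊤-x∣≡n : ∀ {n} (x : Fin n) → suc ∣ ⊤ - x ∣ ≡ n
1+∣⊤-x∣≡n {n} x = begin
  suc ∣ ⊤ - x ∣         ≡⟨ ℕP.+-comm 1 ∣ ⊤ - x ∣ ⟩
  ∣ ⊤ - x ∣ + 1         ≡⟨ cong (∣ ⊤ - x ∣ +_) (SubsetP.∣⁅x⁆∣≡1 x) ⟨
  ∣ ⊤ - x ∣ + ∣ ⁅ x ⁆ ∣ ≡⟨ ∣p─q∣+∣q∣≡∣p∣ ⊤ ⁅ x ⁆ SubsetP.⊆⊤ ⟩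
  ∣ ⊤ {n} ∣             ≡⟨ SubsetP.∣⊤∣≡n n ⟩
  n                     ∎
  where open ≡-Reasoning

≤∣p─q∣ : ∀ {n} {p q : Subset n} {b} → q ⊆ p → ∣ q ∣ + b ≤ ∣ p ∣ → b ≤ ∣ p ─ q ∣
≤∣p─q∣ {p = p} {q} {b} q⊆p ∣q∣+b≤∣p∣ = ℕP.+-cancelʳ-≤ (∣ q ∣) b (∣ p ─ q ∣)
  (subst (b + ∣ q ∣ ≤_) (sym (∣p─q∣+∣q∣≡∣p∣ p q q⊆p)) (subst (_≤ ∣ p ∣) (ℕP.+-comm ∣ q ∣ b) ∣q∣+b≤∣p∣))

≤∣⊤─X∣ : ∀ {n} (X : Subset n) {a b} → ∣ X ∣ ≡ a → a + b ≤ n → b ≤ ∣ ⊤ ─ X ∣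
≤∣⊤─X∣ {n} X {a} {b} refl a+b≤n = ≤∣p─q∣ {q = X} SubsetP.⊆⊤ (subst (a + b ≤_) (sym (SubsetP.∣⊤∣≡n n)) a+b≤n)

≤∣⊤-x─X∣ : ∀ {n} {x : Fin n} {X a b} → X ⊆ ⊤ - x → ∣ X ∣ ≡ a → suc (a + b) ≤ n → b ≤ ∣ (⊤ - x) ─ X ∣
≤∣⊤-x─X∣ {x = x} {a = a} {b} X⊆⊤-x refl a+b<n = ≤∣p─q∣ X⊆⊤-x (ℕP.≤-pred (subst (suc (a + b) ≤_) (sym (1+∣⊤-x∣≡n x)) a+b<n))

∣p─q∣≡ : ∀ {n} (p q : Subset n) {a c d} → ∣ p ∣ ≡ a → ∣ p ∩ q ∣ ≡ c → a ≡ d + c → ∣ p ─ q ∣ ≡ d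
∣p─q∣≡ p q {c = c} {d} refl refl a≡d+c =
  ℕP.+-cancelʳ-≡ c ∣ p ─ q ∣ d (trans (∣p─q∣+∣p∩q∣≡∣p∣ p q) a≡d+c)

∣p∪q∣≡ : ∀ {n} (p q : Subset n) {a b c d} → ∣ p ∣ ≡ a → ∣ q ∣ ≡ b → ∣ p ∩ q ∣ ≡ c → a + b ≡ d + c →
  ∣ p ∪ q ∣ ≡ d
∣p∪q∣≡ p q {c = c} {d} refl refl refl a+b≡d+c =
  ℕP.+-cancelʳ-≡ c ∣ p ∪ q ∣ d (trans (∣p∪q∣+∣p∩q∣≡∣p∣+∣q∣ p q) a+b≡d+c)

record Enumeration {n : ℕ} (k : ℕ) (p : Subset n) : Set where
  field
    element    : Fin k → Fin n
    element∈   : ∀ i → element i ∈ p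
    surjective : ∀ {j} → j ∈ p → ∃ λ i → element i ≡ j

enumerate : ∀ {n k} (p : Subset n) → ∣ p ∣ ≡ k → Enumeration k p
enumerate []          refl = record { element = λ () ; element∈ = λ () ; surjective = λ () }
enumerate (true  ∷ p) refl = record
  { element    = λ { zero → zero ; (suc i) → suc (element i) }
  ; element∈   = λ { zero → here ; (suc i) → there (element∈ i) }
  ; surjective = λ { here → zero , refl ; (there j∈p) → suc (proj₁ (surjective j∈p)) , cong suc (proj₂ (surjective j∈p)) }
  }
  where open Enumeration (enumerate p refl)
enumerate (false ∷ p) ∣p∣≡k = record
  { element    = suc ∘ element
  ; element∈   = there ∘ element∈
  ; surjective = λ { (there j∈p) → proj₁ (surjective j∈p) , cong suc (proj₂ (surjective j∈p)) }
  }
  where open Enumeration (enumerate p ∣p∣≡k)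

∣p∩q∣≡∣p∣⇒p⊆q : ∀ {n} {p q : Subset n} → ∣ p ∩ q ∣ ≡ ∣ p ∣ → p ⊆ q
∣p∩q∣≡∣p∣⇒p⊆q {p = p} {q} same {i} i∈p with i SubsetP.∈? q
... | yes i∈q = i∈q
... | no  i∉q = ⊥-elim (ℕP.<-irrefl same
  (SubsetP.p⊂q⇒∣p∣<∣q∣ (SubsetP.p∩q⊆p p q , i , i∈p , i∉q ∘ proj₂ ∘ SubsetP.x∈p∩q⁻ p q)))

∣p∩q∣≡∣q∩p∣ : ∀ {n} (p q : Subset n) → ∣ p ∩ q ∣ ≡ ∣ q ∩ p ∣
∣p∩q∣≡∣q∩p∣ p q = cong ∣_∣ (SubsetP.∩-comm p q)

∣p∩q∣≡∣p∣≡∣q∣⇒p≡q : ∀ {n} {p q : Subset n} → ∣ p ∩ q ∣ ≡ ∣ p ∣ → ∣ p ∩ q ∣ ≡ ∣ q ∣ → p ≡ q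
∣p∩q∣≡∣p∣≡∣q∣⇒p≡q {p = p} {q} ∣p∩q∣≡∣p∣ ∣p∩q∣≡∣q∣ = SubsetP.⊆-antisym
  (∣p∩q∣≡∣p∣⇒p⊆q ∣p∩q∣≡∣p∣) (∣p∩q∣≡∣p∣⇒p⊆q (trans (∣p∩q∣≡∣q∩p∣ q p) ∣p∩q∣≡∣q∣))

single-difference : ∀ {n} {p q : Subset n} → ∣ p ─ q ∣ ≡ 1 →
  Σ (Fin n) λ a → a ∈ p × a ∉ q × p ≐ λ j → lookup (p ∩ q) j ∨ lookup ⁅ a ⁆ j
single-difference {n} {p} {q} ∣p─q∣≡1 = a , a∈p , a∉q , p≐
  where
  open Enumeration (enumerate (p ─ q) ∣p─q∣≡1)
  a : Fin n
  a = element zero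
  a∈p─q : lookup p a ∧ not (lookup q a) ≡ true
  a∈p─q = ≐⇒⊆ᵇ (≐-─ (≐-lookup p) (≐-lookup q)) a (∈⇒lookup (element∈ zero))
  a∈p : a ∈ p
  a∈p = lookup⇒∈ (∧-trueˡ a∈p─q)
  a∉q : a ∉ q
  a∉q a∈q with subst (λ b → not b ≡ true) (∈⇒lookup a∈q) (∧-trueʳ {lookup p a} a∈p─q)
  ... | ()
  only-a : ∀ {j} → lookup p j ∧ not (lookup q j) ≡ true → j ≡ a
  only-a j∈p─q with surjective (lookup⇒∈ (≐⇒⊇ᵇ (≐-─ (≐-lookup p) (≐-lookup q)) _ j∈p─q))
  ... | zero , a≡j = sym a≡j
  p≐ : p ≐ λ j → lookup (p ∩ q) j ∨ lookup ⁅ a ⁆ j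
  p≐ = mk≐ pointwise
    where
    pointwise : ∀ j → lookup p j ≡ lookup (p ∩ q) j ∨ lookup ⁅ a ⁆ j
    pointwise j with j ≟ a
    ... | yes refl = trans (∈⇒lookup a∈p) (sym (trans (cong (lookup (p ∩ q) a ∨_) (lookup-⁅⁆-self a)) (BoolP.∨-zeroʳ _)))
    ... | no  j≢a  = trans (cases (lookup p j) (lookup q j) λ j∈p─q → j≢a (only-a j∈p─q))
                            (sym (trans (cong₂ _∨_ (lookup-≐ (≐-∩ (≐-lookup p) (≐-lookup q)) j)
                                                   (∉⇒lookup (SubsetP.x≢y⇒x∉⁅y⁆ j≢a)))
                                        (BoolP.∨-identityʳ _)))
      where
      cases : ∀ s t → ¬ (s ∧ not t ≡ true) → s ≡ s ∧ t
      cases true  true  _    = refl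
      cases true  false s∧¬t = ⊥-elim (s∧¬t refl)
      cases false _     _    = refl

infixl 9 _$ᵛ_
infixr 3 _⇒ᶠ_

_$ᵛ_ : ∀ {k} → BoolFun k → Vec Bool k → Bool
b $ᵛ []      = b
f $ᵛ (x ∷ v) = f x $ᵛ v

_⇒ᶠ_ : ∀ {k} → BoolFun k → BoolFun k → BoolFun k
_⇒ᶠ_ {zero}  a b = a ⇒ b
_⇒ᶠ_ {suc k} f g = λ x → f x ⇒ᶠ g x

⇒ᶠ-$ᵛ : ∀ {k} (f g : BoolFun k) v → (f ⇒ᶠ g) $ᵛ v ≡ (f $ᵛ v ⇒ g $ᵛ v)
⇒ᶠ-$ᵛ f g []      = refl
⇒ᶠ-$ᵛ f g (x ∷ v) = ⇒ᶠ-$ᵛ (f x) (g x) v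

tautology-$ᵛ : ∀ {k} {f : BoolFun k} → Tautology k f → ∀ v → f $ᵛ v ≡ true
tautology-$ᵛ taut []      = taut
tautology-$ᵛ taut (x ∷ v) = tautology-$ᵛ (taut x) v

region : ∀ {n k} → Vec (Subset n) k → BoolFun k → Bits n
region atoms F j = F $ᵛ map (λ S → lookup S j) atoms

module Venn {n k : ℕ} (atoms : Vec (Subset n) k)
            (Disjoint : BoolFun k) (disjoint : ∀ j → region atoms Disjoint j ≡ true) where

  infix 4 _⊆ʳ_

  _⊆ʳ_ : (F G : BoolFun k) {_ : True (tautology? k (Disjoint ⇒ᶠ F ⇒ᶠ G))} → region atoms F ⊆ᵇ region atoms G
  (F ⊆ʳ G) {table} j j∈F = modus-ponens (modus-ponens implication (disjoint j)) j∈F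
    where
    v : Vec Bool k
    v = map (λ S → lookup S j) atoms
    implication : (Disjoint $ᵛ v ⇒ F $ᵛ v ⇒ G $ᵛ v) ≡ true
    implication = trans (sym (trans (⇒ᶠ-$ᵛ Disjoint (F ⇒ᶠ G) v) (cong (Disjoint $ᵛ v ⇒_) (⇒ᶠ-$ᵛ F G v))))
                        (tautology-$ᵛ (toWitness table) v)

-- Cut rank and quads

module _ {n : ℕ} (G : Graph n) where

  RowsInSpan₂ : (M : Bits n) → Subset n → (p q : Bits n) → Set
  RowsInSpan₂ M X p q = ∀ i → i ∈ X → InSpan₂ M p q (adj G i)

  cutRank≤2⇒rowsInSpan₂ : ∀ {S X} → CutRankLe G S X 2 →
    Σ (Bits n) λ p → Σ (Bits n) λ q → RowsInSpan₂ (lookup (S ─ X)) X p q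
  cutRank≤2⇒rowsInSpan₂ {S} {X} (v , rows) = v zero , v (suc zero) , λ i i∈X → coefficients (rows i i∈X)
    where
    coefficients : ∀ {i} → (Σ (Fin 2 → Bool) λ c → ∀ j → cutEntry G S X i j ≡ Σ₂ (λ t → c t ∧ v t j)) →
      InSpan₂ (lookup (S ─ X)) (v zero) (v (suc zero)) (adj G i)
    coefficients {i} (c , h) = c zero , c (suc zero) , λ j j∈S─X →
      trans (sym (cong (_∧ adj G i j) j∈S─X))
            (trans (h j) (cong (c zero ∧ v zero j xor_) (BoolP.xor-identityʳ _)))

  rowsInSpan₂⇒cutRank≤2 : ∀ S X {p q} → RowsInSpan₂ (lookup (S ─ X)) X p q → CutRankLe G S X 2
  rowsInSpan₂⇒cutRank≤2 S X {p} {q} rows = v , λ i i∈X → coefficients (rows i i∈X)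
    where
    v : Fin 2 → Bits n
    v zero       j = lookup (S ─ X) j ∧ p j
    v (suc zero) j = lookup (S ─ X) j ∧ q j
    coefficients : ∀ {i} → InSpan₂ (lookup (S ─ X)) p q (adj G i) →
      Σ (Fin 2 → Bool) λ c → ∀ j → cutEntry G S X i j ≡ Σ₂ (λ t → c t ∧ v t j)
    coefficients {i} (e₁ , e₂ , h) = (λ { zero → e₁ ; (suc zero) → e₂ }) , entry
      where
      entry : ∀ j → cutEntry G S X i j ≡ e₁ ∧ v zero j xor (e₂ ∧ v (suc zero) j xor false)
      entry j with lookup (S ─ X) j in j∈S─X
      ... | true  = trans (h j j∈S─X) (cong (e₁ ∧ p j xor_) (sym (BoolP.xor-identityʳ _)))
      ... | false = sym (zeros e₁ e₂)
        where
        zeros : ∀ a b → a ∧ false xor (b ∧ false xor false) ≡ false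
        zeros a b rewrite BoolP.∧-zeroʳ a | BoolP.∧-zeroʳ b = refl

  cutRankLe-suc : ∀ {S X m} → CutRankLe G S X m → CutRankLe G S X (suc m)
  cutRankLe-suc {S} {X} {m} (v , rows) = v′ , λ i i∈X → pad (rows i i∈X)
    where
    v′ : Fin (suc m) → Bits n
    v′ zero    _ = false
    v′ (suc t)   = v t
    pad : ∀ {i} → (Σ (Fin m → Bool) λ c → ∀ j → cutEntry G S X i j ≡ Σ₂ (λ t → c t ∧ v t j)) →
      Σ (Fin (suc m) → Bool) λ c → ∀ j → cutEntry G S X i j ≡ Σ₂ (λ t → c t ∧ v′ t j)
    pad (c , h) = (λ { zero → false ; (suc t) → c t }) , h

  cutRankLe-mono : ∀ {S X m k} → m ≤′ k → CutRankLe G S X m → CutRankLe G S X k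
  cutRankLe-mono         ≤′-refl       low = low
  cutRankLe-mono {S} {X} (≤′-step m≤k) low = cutRankLe-suc {S} {X} (cutRankLe-mono {S} {X} m≤k low)

  -- The rank need not be decidable, so only the double negation of its existence is available.
  ¬¬cutRank : ∀ {S X} k → CutRankLe G S X k → ¬ ¬ (Σ ℕ λ r → CutRank G S X r × r ≤ k)
  ¬¬cutRank         zero    low no-rank = no-rank (0 , (low , λ _ _ → z≤n) , z≤n)
  ¬¬cutRank {S} {X} (suc k) low no-rank = lower-impossible λ lower →
    ¬¬cutRank {S} {X} k lower λ { (r , rank , r≤k) → no-rank (r , rank , ℕP.m≤n⇒m≤1+n r≤k) }
    where
    lower-impossible : ¬ ¬ CutRankLe G S X k
    lower-impossible ¬lower = no-rank (suc k , (low , least) , ℕP.≤-refl)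
      where
      least : ∀ m → CutRankLe G S X m → suc k ≤ m
      least m low-m with m ≤? k
      ... | yes m≤k = ⊥-elim (¬lower (cutRankLe-mono {S} {X} (ℕP.≤⇒≤′ m≤k) low-m))
      ... | no  m≰k = ℕP.≰⇒> m≰k

  rankConnected⇒¬cutRankLe : ∀ {k S X m} → RankConnected k G S → X ⊆ S →
    m < k → m < ∣ X ∣ → m < ∣ S ─ X ∣ → ¬ CutRankLe G S X m
  rankConnected⇒¬cutRankLe {S = S} {X} conn X⊆S m<k m<∣X∣ m<∣S─X∣ low = ¬¬cutRank {S} {X} _ low λ (r , rank , r≤m) →
    conn (X , r , X⊆S , rank , ℕP.≤-<-trans r≤m m<∣X∣ , ℕP.≤-<-trans r≤m m<∣S─X∣ , ℕP.≤-<-trans r≤m m<k)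

  weaklyThreeRankConnected⇒¬cutRank≤2 : ∀ {S X} → WeaklyThreeRankConnected G S → X ⊆ S →
    5 ≤ ∣ X ∣ → 5 ≤ ∣ S ─ X ∣ → ¬ CutRankLe G S X 2
  weaklyThreeRankConnected⇒¬cutRank≤2 {S} {X} (_ , no-separation) X⊆S 5≤∣X∣ 5≤∣S─X∣ low =
    ¬¬cutRank {S} {X} 2 low λ (r , rank , r≤2) → no-separation (X , r , X⊆S , 5≤∣X∣ , 5≤∣S─X∣ , rank , r≤2)

  quad-minus-¬cutRank≤2 : ∀ {S P z} → Quad G S P → z ∈ P → ¬ CutRankLe G S (P - z) 2
  quad-minus-¬cutRank≤2 (_ , _ , _ , rank-minus) z∈P low with proj₂ (rank-minus _ z∈P) 2 low
  ... | s≤s (s≤s ())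

  rowsInSpan₂-mono : ∀ {M N X p q} → N ⊆ᵇ M → RowsInSpan₂ M X p q → RowsInSpan₂ N X p q
  rowsInSpan₂-mono N⊆M rows i i∈X = inSpan₂-mono N⊆M (rows i i∈X)

  quad⇒rowsInSpan₂ : ∀ {S P M} → Quad G S P → S ─ P ≐ M → Σ (Bits n) λ p → Σ (Bits n) λ q → RowsInSpan₂ M P p q
  quad⇒rowsInSpan₂ {S} {P} (_ , _ , rank , _) S─P≐M with cutRank≤2⇒rowsInSpan₂ {S} {P} (proj₁ rank)
  ... | p , q , rows = p , q , rowsInSpan₂-mono (≐⇒⊇ᵇ S─P≐M) rows

  -- If the rows of P - z were multiples of one vector off P, adding the indicator of z would
  -- give ρ(P - z) ≤ 2.
  quad-rows-independent : ∀ {S P M z k} → Quad G S P → S ─ P ≐ M → z ∈ P → (t : Fin k → Fin n) →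
    (∀ {i} → i ∈ P - z → ∃ λ l → t l ≡ i) →
    Σ (Fin k) λ l → Σ (Fin k) λ l′ → ¬ Dependent₂ M (adj G (t l)) (adj G (t l′))
  quad-rows-independent {S} {P} {M} {z} quad S─P≐M z∈P t cover with single-or-independent (λ l → adj G (t l))
  ... | inj₂ pair           = pair
  ... | inj₁ (u , multiple) =
    ⊥-elim (quad-minus-¬cutRank≤2 {S} {P} quad z∈P (rowsInSpan₂⇒cutRank≤2 S (P - z) rows))
    where
    off-P : lookup ((S ─ (P - z)) - z) ⊆ᵇ M
    off-P = ⊆ᵇ-trans (≐⇒⊆ᵇ (≐-─ (≐-─ (≐-lookup S) (≐-─ (≐-lookup P) (≐-lookup ⁅ z ⁆))) (≐-lookup ⁅ z ⁆)))
           (⊆ᵇ-trans ((λ σ π ζ → (σ ∧ not (π ∧ not ζ)) ∧ not ζ) ⊆ʳ (λ σ π ζ → σ ∧ not π))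
                     (⊆ᵇ-trans (≐⇒⊇ᵇ (≐-─ (≐-lookup S) (≐-lookup P))) (≐⇒⊆ᵇ S─P≐M)))
      where open Venn (S ∷ P ∷ ⁅ z ⁆ ∷ []) (λ _ _ _ → true) (λ _ → refl)
    rows : RowsInSpan₂ (lookup (S ─ (P - z))) (P - z) (λ j → not (lookup ⁅ z ⁆ j) ∧ u j) (lookup ⁅ z ⁆)
    rows i i∈P-z with cover i∈P-z
    ... | l , refl = inSpan₂-insert {N = S ─ (P - z)} z off-P (multiple l)

  module _ {S P : Subset n} {M : Bits n} {z : Fin n} {k : ℕ} (quad : Quad G S P) (S─P≐M : S ─ P ≐ M) (z∈P : z ∈ P)
           (t : Fin k → Fin n) (t∈P : ∀ l → t l ∈ P) (cover : ∀ {i} → i ∈ P - z → ∃ λ l → t l ≡ i) where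

    quad-point-collinear : ∀ {N w} → N ⊆ᵇ M → (∀ l → InSpan₁ N w (adj G (t l))) → InSpan₁ N w (adj G z)
    quad-point-collinear N⊆M collinear with quad-rows-independent quad S─P≐M z∈P t cover | quad⇒rowsInSpan₂ quad S─P≐M
    ... | l , l′ , indep | p , q , rows = inSpan₁-trans
      (inSpan₂-mono N⊆M (span₂-of-independent indep (rows _ (t∈P l)) (rows _ (t∈P l′)) (rows z z∈P)))
      (collinear l) (collinear l′)

    quad-span₂-absorbs : ∀ {p q p′ q′ w} → RowsInSpan₂ M P p q →
      (∀ l → InSpan₂ M p′ q′ (adj G (t l))) → InSpan₂ M p′ q′ w → InSpan₂ M p q w
    quad-span₂-absorbs rows spans w-span with quad-rows-independent quad S─P≐M z∈P t cover
    ... | l , l′ , indep =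
      inSpan₂-trans (span₂-of-independent indep (spans l) (spans l′) w-span) (rows _ (t∈P l)) (rows _ (t∈P l′))

module EqualQuads {n : ℕ} (G : Graph n) {x y : Fin n} {A : Subset n} (x≢y : x ≢ y)
                  (quad-x : Quad G (⊤ - x) A) (quad-y : Quad G (⊤ - y) A) where

  x∉A : x ∉ A
  x∉A = x∉p-x ∘ proj₁ quad-x

  y∉A : y ∉ A
  y∉A = x∉p-x ∘ proj₁ quad-y

  atoms : Vec (Subset n) 3
  atoms = A ∷ ⁅ x ⁆ ∷ ⁅ y ⁆ ∷ []

  open Venn atoms (λ α ξ η → not (α ∧ ξ) ∧ not (α ∧ η) ∧ not (ξ ∧ η))
    (λ j → ∧-true (disjoint-⁅⁆ x∉A j) (∧-true (disjoint-⁅⁆ y∉A j) (disjoint-⁅⁆ (SubsetP.x≢y⇒x∉⁅y⁆ (x≢y ∘ sym)) j)))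

  off-x off-y off-xy : Bits n
  off-x  = region atoms λ α ξ η → not ξ ∧ not α
  off-y  = region atoms λ α ξ η → not η ∧ not α
  off-xy = region atoms λ α ξ η → (not ξ ∧ not α) ∧ (not η ∧ not α)

  open Enumeration (enumerate A (proj₁ (proj₂ quad-x)))

  row : Fin 4 → Bits n
  row l = adj G (element l)

  span-x : Σ (Bits n) λ p → Σ (Bits n) λ q → RowsInSpan₂ G off-x A p q
  span-x = quad⇒rowsInSpan₂ G quad-x (≐-─ (≐-─ ≐-⊤ (≐-lookup ⁅ x ⁆)) (≐-lookup A))

  span-y : Σ (Bits n) λ p → Σ (Bits n) λ q → RowsInSpan₂ G off-y A p q
  span-y = quad⇒rowsInSpan₂ G quad-y (≐-─ (≐-─ ≐-⊤ (≐-lookup ⁅ y ⁆)) (≐-lookup A))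

  -- With the rows of A multiples of u off A ∪ {x, y}, the five rows of A ∪ {x} lie in the span
  -- of u and the row of x off A ∪ {x} in G \ y.
  collapsed-rows-impossible : 12 ≤ n → WeaklyThreeRankConnected G (⊤ - y) →
    (u : Bits n) → (∀ l → InSpan₁ off-xy u (row l)) → ⊥
  collapsed-rows-impossible n≥12 weakly u multiple =
    weaklyThreeRankConnected⇒¬cutRank≤2 G weakly X⊆⊤-y (ℕP.≤-reflexive (sym ∣X∣≡5))
      (≤∣⊤-x─X∣ X⊆⊤-y ∣X∣≡5 (ℕP.≤-trans (ℕP.m≤m+n 11 1) n≥12))
      (rowsInSpan₂⇒cutRank≤2 G (⊤ - y) X rows)
    where
    X : Subset n
    X = A ∪ ⁅ x ⁆
    X≐ : X ≐ region atoms λ α ξ η → α ∨ ξ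
    X≐ = ≐-∪ (≐-lookup A) (≐-lookup ⁅ x ⁆)
    X⊆⊤-y : X ⊆ ⊤ - y
    X⊆⊤-y = ⊆ᵇ⇒⊆ (⊆ᵇ-trans (≐⇒⊆ᵇ X≐) (⊆ᵇ-trans ((λ α ξ η → α ∨ ξ) ⊆ʳ (λ α ξ η → not η))
                                                  (≐⇒⊇ᵇ (≐-─ ≐-⊤ (≐-lookup ⁅ y ⁆)))))
    ∣X∣≡5 : ∣ X ∣ ≡ 5
    ∣X∣≡5 = trans (∣p∪⁅x⁆∣≡1+∣p∣ A x x∉A) (cong suc (proj₁ (proj₂ quad-x)))
    off-X⊆off-xy : lookup ((⊤ - y) ─ X) ⊆ᵇ off-xy
    off-X⊆off-xy = ⊆ᵇ-trans (≐⇒⊆ᵇ (≐-─ (≐-─ ≐-⊤ (≐-lookup ⁅ y ⁆)) X≐))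
                            ((λ α ξ η → not η ∧ not (α ∨ ξ)) ⊆ʳ (λ α ξ η → (not ξ ∧ not α) ∧ (not η ∧ not α)))
    rows : RowsInSpan₂ G (lookup ((⊤ - y) ─ X)) X u (adj G x)
    rows i i∈X with SubsetP.x∈p∪q⁻ A ⁅ x ⁆ i∈X
    ... | inj₂ i∈⁅x⁆ rewrite SubsetP.x∈⁅y⁆⇒x≡y x i∈⁅x⁆ = span₂-right
    ... | inj₁ i∈A with surjective i∈A
    ...   | l , refl with multiple l
    ...     | f , h = f , false , λ j j∈off → trans (h j (off-X⊆off-xy j j∈off)) (sym (BoolP.xor-identityʳ _))

  independent-rows-impossible : 12 ≤ n → RankConnected 3 G ⊤ →
    (l l′ : Fin 4) → ¬ Dependent₂ off-xy (row l) (row l′) → ⊥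
  independent-rows-impossible n≥12 conn l l′ indep =
    rankConnected⇒¬cutRankLe G {X = A} conn SubsetP.⊆⊤ ℕP.≤-refl (subst (2 <_) (sym ∣A∣≡4) (s≤s (s≤s (s≤s z≤n))))
      (≤∣⊤─X∣ A ∣A∣≡4 (ℕP.≤-trans (ℕP.m≤m+n 7 5) n≥12)) (rowsInSpan₂⇒cutRank≤2 G ⊤ A rows)
    where
    ∣A∣≡4 : ∣ A ∣ ≡ 4
    ∣A∣≡4 = proj₁ (proj₂ quad-x)
    rows : RowsInSpan₂ G (lookup (⊤ ─ A)) A (row l) (row l′)
    rows i i∈A with surjective i∈A | span-x | span-y
    ... | m , refl | p , q , rows-x | p′ , q′ , rows-y =
      inSpan₂-mono (⊆ᵇ-trans (≐⇒⊆ᵇ (≐-─ ≐-⊤ (≐-lookup A)))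
                             ((λ α ξ η → not α) ⊆ʳ (λ α ξ η → (not ξ ∧ not α) ∨ (not η ∧ not α))))
        (inSpan₂-∪ indep
          (span₂-of-independent (indep ∘ dependent₂-mono (λ j → ∧-trueˡ))
            (rows-x _ (element∈ l)) (rows-x _ (element∈ l′)) (rows-x _ (element∈ m)))
          (span₂-of-independent (indep ∘ dependent₂-mono (λ j → ∧-trueʳ {off-x j}))
            (rows-y _ (element∈ l)) (rows-y _ (element∈ l′)) (rows-y _ (element∈ m))))

  equal-quads-impossible : 12 ≤ n → RankConnected 3 G ⊤ → WeaklyThreeRankConnected G (⊤ - y) → ⊥
  equal-quads-impossible n≥12 conn weakly with single-or-independent {M = off-xy} row
  ... | inj₁ (u , multiple)   = collapsed-rows-impossible n≥12 weakly u multiple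
  ... | inj₂ (l , l′ , indep) = independent-rows-impossible n≥12 conn l l′ indep

module OverlapThree {n : ℕ} (G : Graph n) {x y a b : Fin n} {A B T : Subset n}
  (x≢y : x ≢ y) (b≢x : b ≢ x) (a∉B : a ∉ B) (b∉A : b ∉ A)
  (A≐ : A ≐ λ j → lookup T j ∨ lookup ⁅ a ⁆ j) (B≐ : B ≐ λ j → lookup T j ∨ lookup ⁅ b ⁆ j)
  (∣T∣≡3 : ∣ T ∣ ≡ 3) (∣A∪B∣≡5 : ∣ A ∪ B ∣ ≡ 5)
  (quad-x : Quad G (⊤ - x) A) (quad-y : Quad G (⊤ - y) B) where

  T⊆A : T ⊆ A
  T⊆A = ≐∨⇒⊆ A≐

  T⊆B : T ⊆ B
  T⊆B = ≐∨⇒⊆ B≐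

  a∈A : a ∈ A
  a∈A = ≐∨⁅⁆⇒∈ A≐

  b∈B : b ∈ B
  b∈B = ≐∨⁅⁆⇒∈ B≐

  x∉A : x ∉ A
  x∉A = x∉p-x ∘ proj₁ quad-x

  y∉B : y ∉ B
  y∉B = x∉p-x ∘ proj₁ quad-y

  b∉⁅a⁆ : b ∉ ⁅ a ⁆
  b∉⁅a⁆ = SubsetP.x≢y⇒x∉⁅y⁆ λ { refl → b∉A a∈A }

  x∉⁅a⁆ : x ∉ ⁅ a ⁆
  x∉⁅a⁆ = SubsetP.x≢y⇒x∉⁅y⁆ λ { refl → x∉A a∈A }

  y∉⁅b⁆ : y ∉ ⁅ b ⁆
  y∉⁅b⁆ = SubsetP.x≢y⇒x∉⁅y⁆ λ { refl → y∉B b∈B }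

  atoms : Vec (Subset n) 5
  atoms = T ∷ ⁅ a ⁆ ∷ ⁅ b ⁆ ∷ ⁅ x ⁆ ∷ ⁅ y ⁆ ∷ []

  -- a = y is not excluded, so {a} and {y} need not be disjoint.
  open Venn atoms
    (λ τ α β ξ η → not (τ ∧ α) ∧ not (τ ∧ β) ∧ not (τ ∧ ξ) ∧ not (τ ∧ η) ∧
                   not (α ∧ β) ∧ not (α ∧ ξ) ∧ not (β ∧ η) ∧ not (ξ ∧ η) ∧ not (β ∧ ξ))
    (λ j → ∧-true (disjoint-⁅⁆ (a∉B ∘ T⊆B) j) (∧-true (disjoint-⁅⁆ (b∉A ∘ T⊆A) j)
           (∧-true (disjoint-⁅⁆ (x∉A ∘ T⊆A) j) (∧-true (disjoint-⁅⁆ (y∉B ∘ T⊆B) j)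
           (∧-true (disjoint-⁅⁆ b∉⁅a⁆ j) (∧-true (disjoint-⁅⁆ x∉⁅a⁆ j) (∧-true (disjoint-⁅⁆ y∉⁅b⁆ j)
           (∧-true (disjoint-⁅⁆ (SubsetP.x≢y⇒x∉⁅y⁆ (x≢y ∘ sym)) j)
                   (disjoint-⁅⁆ (SubsetP.x≢y⇒x∉⁅y⁆ (b≢x ∘ sym)) j)))))))))

  off-A off-B off-AB : Bits n
  off-A  = region atoms λ τ α β ξ η → not ξ ∧ not (τ ∨ α)
  off-B  = region atoms λ τ α β ξ η → not η ∧ not (τ ∨ β)
  off-AB = region atoms λ τ α β ξ η → (not ξ ∧ not (τ ∨ α)) ∧ (not η ∧ not (τ ∨ β))

  off-A≐ : (⊤ - x) ─ A ≐ off-A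
  off-A≐ = ≐-─ (≐-─ ≐-⊤ (≐-lookup ⁅ x ⁆)) A≐

  off-B≐ : (⊤ - y) ─ B ≐ off-B
  off-B≐ = ≐-─ (≐-─ ≐-⊤ (≐-lookup ⁅ y ⁆)) B≐

  open Enumeration (enumerate T ∣T∣≡3) renaming (element to t; element∈ to t∈T)

  row : Fin 3 → Bits n
  row l = adj G (t l)

  A-a⊆T : A - a ⊆ T
  A-a⊆T = ⊆ᵇ⇒⊆ (⊆ᵇ-trans (≐⇒⊆ᵇ (≐-─ A≐ (≐-lookup ⁅ a ⁆)))
                          ((λ τ α β ξ η → (τ ∨ α) ∧ not α) ⊆ʳ (λ τ α β ξ η → τ)))

  B-b⊆T : B - b ⊆ T
  B-b⊆T = ⊆ᵇ⇒⊆ (⊆ᵇ-trans (≐⇒⊆ᵇ (≐-─ B≐ (≐-lookup ⁅ b ⁆)))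
                          ((λ τ α β ξ η → (τ ∨ β) ∧ not β) ⊆ʳ (λ τ α β ξ η → τ)))

  relation-A : Relation₃ off-A row
  relation-A with quad⇒rowsInSpan₂ G quad-x off-A≐
  ... | _ , _ , rows = relation-of-three-in-span₂ λ l → rows _ (T⊆A (t∈T l))

  relation-B : Relation₃ off-B row
  relation-B with quad⇒rowsInSpan₂ G quad-y off-B≐
  ... | _ , _ , rows = relation-of-three-in-span₂ λ l → rows _ (T⊆B (t∈T l))

  open Relation₃

  -- A common relation would hold off B - b, where the rows of B - b = T would then span
  -- only two dimensions.
  relations-differ : coefficients relation-A ≢ coefficients relation-B
  relations-differ same = quad-minus-¬cutRank≤2 G quad-y b∈B (rowsInSpan₂⇒cutRank≤2 G (⊤ - y) (B - b) rows)
    where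
    off-B-b⊆off-A∪off-B : lookup ((⊤ - y) ─ (B - b)) ⊆ᵇ λ j → off-A j ∨ off-B j
    off-B-b⊆off-A∪off-B = ⊆ᵇ-trans (≐⇒⊆ᵇ (≐-─ (≐-─ ≐-⊤ (≐-lookup ⁅ y ⁆)) (≐-─ B≐ (≐-lookup ⁅ b ⁆))))
      ((λ τ α β ξ η → not η ∧ not ((τ ∨ β) ∧ not β)) ⊆ʳ
       (λ τ α β ξ η → (not ξ ∧ not (τ ∨ α)) ∨ (not η ∧ not (τ ∨ β))))
    relation-off-B-b : Relation₃ (lookup ((⊤ - y) ─ (B - b))) row
    relation-off-B-b = relation (coefficients relation-A) (nontrivial relation-A) λ j j∈off →
      [ vanishes relation-A j
      , (λ j∈off-B → subst (λ e → combination e (at₃ row j) ≡ false) (sym same) (vanishes relation-B j j∈off-B))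
      ]′ (∨-true⇒⊎ (off-B-b⊆off-A∪off-B j j∈off))
    spanning : Σ (Bits n) λ p → Σ (Bits n) λ q → ∀ l → InSpan₂ (lookup ((⊤ - y) ─ (B - b))) p q (row l)
    spanning = span₂-of-relation relation-off-B-b
    rows : RowsInSpan₂ G (lookup ((⊤ - y) ─ (B - b))) (B - b) (proj₁ spanning) (proj₁ (proj₂ spanning))
    rows i i∈B-b with surjective (B-b⊆T i∈B-b)
    ... | l , refl = proj₂ (proj₂ spanning) l

  common-line : Σ (Bits n) λ w → ∀ l → InSpan₁ off-AB w (row l)
  common-line = span₁-of-two-relations (relation₃-mono (λ j → ∧-trueˡ) relation-A)
                                       (relation₃-mono (λ j → ∧-trueʳ {off-A j}) relation-B) relations-differ

  w : Bits n
  w = proj₁ common-line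

  a-on-line : InSpan₁ off-AB w (adj G a)
  a-on-line = quad-point-collinear G quad-x off-A≐ a∈A t (T⊆A ∘ t∈T) (surjective ∘ A-a⊆T)
                (λ j → ∧-trueˡ) (proj₂ common-line)

  b-on-line : InSpan₁ off-AB w (adj G b)
  b-on-line = quad-point-collinear G quad-y off-B≐ b∈B t (T⊆B ∘ t∈T) (surjective ∘ B-b⊆T)
                (λ j → ∧-trueʳ {off-A j}) (proj₂ common-line)

  -- All five rows of A ∪ B are multiples of w off A ∪ B ∪ {y}; the indicator of y then shows
  -- that A ∪ B is a separation of order at most two of G \ x.
  overlap-impossible : 12 ≤ n → WeaklyThreeRankConnected G (⊤ - x) → ⊥
  overlap-impossible n≥12 weakly =
    weaklyThreeRankConnected⇒¬cutRank≤2 G weakly X⊆⊤-x (ℕP.≤-reflexive (sym ∣A∪B∣≡5))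
      (≤∣⊤-x─X∣ X⊆⊤-x ∣A∪B∣≡5 (ℕP.≤-trans (ℕP.m≤m+n 11 1) n≥12))
      (rowsInSpan₂⇒cutRank≤2 G (⊤ - x) X rows)
    where
    X : Subset n
    X = A ∪ B
    X≐ : X ≐ region atoms λ τ α β ξ η → (τ ∨ α) ∨ (τ ∨ β)
    X≐ = ≐-∪ A≐ B≐
    X⊆⊤-x : X ⊆ ⊤ - x
    X⊆⊤-x = ⊆ᵇ⇒⊆ (⊆ᵇ-trans (≐⇒⊆ᵇ X≐) (⊆ᵇ-trans ((λ τ α β ξ η → (τ ∨ α) ∨ (τ ∨ β)) ⊆ʳ (λ τ α β ξ η → not ξ))
                                                  (≐⇒⊇ᵇ (≐-─ ≐-⊤ (≐-lookup ⁅ x ⁆)))))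
    off-X-y⊆off-AB : lookup (((⊤ - x) ─ X) - y) ⊆ᵇ off-AB
    off-X-y⊆off-AB = ⊆ᵇ-trans (≐⇒⊆ᵇ (≐-─ (≐-─ (≐-─ ≐-⊤ (≐-lookup ⁅ x ⁆)) X≐) (≐-lookup ⁅ y ⁆)))
      ((λ τ α β ξ η → (not ξ ∧ not ((τ ∨ α) ∨ (τ ∨ β))) ∧ not η) ⊆ʳ
       (λ τ α β ξ η → (not ξ ∧ not (τ ∨ α)) ∧ (not η ∧ not (τ ∨ β))))
    on-line : ∀ i → i ∈ X → InSpan₁ off-AB w (adj G i)
    on-line i i∈X with ∨-true⇒⊎ (((λ τ α β ξ η → (τ ∨ α) ∨ (τ ∨ β)) ⊆ʳ (λ τ α β ξ η → τ ∨ α ∨ β))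
                                   i (≐⇒⊆ᵇ X≐ i (∈⇒lookup i∈X)))
    ... | inj₁ i∈T with surjective (lookup⇒∈ i∈T)
    ...   | l , refl = proj₂ common-line l
    on-line i i∈X | inj₂ i∈⁅a⁆∪⁅b⁆ with ∨-true⇒⊎ i∈⁅a⁆∪⁅b⁆
    ... | inj₁ i∈⁅a⁆ = subst (InSpan₁ off-AB w ∘ adj G) (sym (lookup-⁅⁆⇒≡ i∈⁅a⁆)) a-on-line
    ... | inj₂ i∈⁅b⁆ = subst (InSpan₁ off-AB w ∘ adj G) (sym (lookup-⁅⁆⇒≡ i∈⁅b⁆)) b-on-line
    rows : RowsInSpan₂ G (lookup ((⊤ - x) ─ X)) X (λ j → not (lookup ⁅ y ⁆ j) ∧ w j) (lookup ⁅ y ⁆)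
    rows i i∈X = inSpan₂-insert {N = (⊤ - x) ─ X} y off-X-y⊆off-AB (on-line i i∈X)

module CrossedOverlap {n : ℕ} (G : Graph n) {x y : Fin n} {A B T : Subset n} (x≢y : x ≢ y)
  (A≐ : A ≐ λ j → lookup T j ∨ lookup ⁅ y ⁆ j) (B≐ : B ≐ λ j → lookup T j ∨ lookup ⁅ x ⁆ j)
  (∣T∣≡3 : ∣ T ∣ ≡ 3) (∣A∪B∣≡5 : ∣ A ∪ B ∣ ≡ 5)
  (quad-x : Quad G (⊤ - x) A) (quad-y : Quad G (⊤ - y) B) where

  T⊆A : T ⊆ A
  T⊆A = ≐∨⇒⊆ A≐

  T⊆B : T ⊆ B
  T⊆B = ≐∨⇒⊆ B≐

  y∈A : y ∈ A
  y∈A = ≐∨⁅⁆⇒∈ A≐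

  x∈B : x ∈ B
  x∈B = ≐∨⁅⁆⇒∈ B≐

  atoms : Vec (Subset n) 3
  atoms = T ∷ ⁅ x ⁆ ∷ ⁅ y ⁆ ∷ []

  open Venn atoms (λ τ ξ η → not (τ ∧ ξ) ∧ not (τ ∧ η) ∧ not (ξ ∧ η))
    (λ j → ∧-true (disjoint-⁅⁆ (x∉p-x ∘ proj₁ quad-x ∘ T⊆A) j)
           (∧-true (disjoint-⁅⁆ (x∉p-x ∘ proj₁ quad-y ∘ T⊆B) j) (disjoint-⁅⁆ (SubsetP.x≢y⇒x∉⁅y⁆ (x≢y ∘ sym)) j)))

  off-A off-B : Bits n
  off-A = region atoms λ τ ξ η → not ξ ∧ not (τ ∨ η)
  off-B = region atoms λ τ ξ η → not η ∧ not (τ ∨ ξ)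

  off-A≐ : (⊤ - x) ─ A ≐ off-A
  off-A≐ = ≐-─ (≐-─ ≐-⊤ (≐-lookup ⁅ x ⁆)) A≐

  off-B≐ : (⊤ - y) ─ B ≐ off-B
  off-B≐ = ≐-─ (≐-─ ≐-⊤ (≐-lookup ⁅ y ⁆)) B≐

  off-A⊆off-B : off-A ⊆ᵇ off-B
  off-A⊆off-B = (λ τ ξ η → not ξ ∧ not (τ ∨ η)) ⊆ʳ (λ τ ξ η → not η ∧ not (τ ∨ ξ))

  open Enumeration (enumerate T ∣T∣≡3) renaming (element to t; element∈ to t∈T)

  A-y⊆T : A - y ⊆ T
  A-y⊆T = ⊆ᵇ⇒⊆ (⊆ᵇ-trans (≐⇒⊆ᵇ (≐-─ A≐ (≐-lookup ⁅ y ⁆))) ((λ τ ξ η → (τ ∨ η) ∧ not η) ⊆ʳ (λ τ ξ η → τ)))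

  span-A : Σ (Bits n) λ p → Σ (Bits n) λ q → RowsInSpan₂ G off-A A p q
  span-A = quad⇒rowsInSpan₂ G quad-x off-A≐

  p q : Bits n
  p = proj₁ span-A
  q = proj₁ (proj₂ span-A)

  rows-A : RowsInSpan₂ G off-A A p q
  rows-A = proj₂ (proj₂ span-A)

  x-in-span : InSpan₂ off-A p q (adj G x)
  x-in-span with quad⇒rowsInSpan₂ G quad-y off-B≐
  ... | _ , _ , rows-B = quad-span₂-absorbs G quad-x off-A≐ y∈A t (T⊆A ∘ t∈T) (surjective ∘ A-y⊆T) rows-A
          (λ l → inSpan₂-mono off-A⊆off-B (rows-B _ (T⊆B (t∈T l)))) (inSpan₂-mono off-A⊆off-B (rows-B x x∈B))

  rows-A∪B : RowsInSpan₂ G off-A (A ∪ B) p q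
  rows-A∪B i i∈A∪B = on-A (SubsetP.x∈p∪q⁻ A B i∈A∪B)
    where
    on-A : i ∈ A ⊎ i ∈ B → InSpan₂ off-A p q (adj G i)
    on-A (inj₁ i∈A) = rows-A i i∈A
    on-A (inj₂ i∈B) with ∨-true⇒⊎ (≐⇒⊆ᵇ B≐ i (∈⇒lookup i∈B))
    ... | inj₁ i∈T   = rows-A i (T⊆A (lookup⇒∈ i∈T))
    ... | inj₂ i∈⁅x⁆ = subst (InSpan₂ off-A p q ∘ adj G) (sym (lookup-⁅⁆⇒≡ i∈⁅x⁆)) x-in-span

  off-A∪B⊆off-A : lookup (⊤ ─ (A ∪ B)) ⊆ᵇ off-A
  off-A∪B⊆off-A = ⊆ᵇ-trans (≐⇒⊆ᵇ (≐-─ ≐-⊤ (≐-∪ A≐ B≐)))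
                           ((λ τ ξ η → not ((τ ∨ η) ∨ (τ ∨ ξ))) ⊆ʳ (λ τ ξ η → not ξ ∧ not (τ ∨ η)))

  crossed-overlap-impossible : 12 ≤ n → RankConnected 3 G ⊤ → ⊥
  crossed-overlap-impossible n≥12 conn =
    rankConnected⇒¬cutRankLe G {S = ⊤} {X = A ∪ B} conn SubsetP.⊆⊤ ℕP.≤-refl
      (subst (2 <_) (sym ∣A∪B∣≡5) (ℕP.m≤m+n 3 2))
      (≤∣⊤─X∣ (A ∪ B) ∣A∪B∣≡5 (ℕP.≤-trans (ℕP.m≤m+n 8 4) n≥12))
      (rowsInSpan₂⇒cutRank≤2 G ⊤ (A ∪ B) (rowsInSpan₂-mono G off-A∪B⊆off-A rows-A∪B))

module _ {n : ℕ} (G : Graph n) {x y : Fin n} {A B : Subset n} where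

  overlap-three-cases : 12 ≤ n → RankConnected 3 G ⊤ → x ≢ y →
    WeaklyThreeRankConnected G (⊤ - x) → WeaklyThreeRankConnected G (⊤ - y) →
    Quad G (⊤ - x) A → Quad G (⊤ - y) B → ∣ A ∩ B ∣ ≡ 3 → ∣ A ∪ B ∣ ≡ 5 → ∣ B ∪ A ∣ ≡ 5 →
    ∀ {a b} → a ∉ B → b ∉ A →
    A ≐ (λ j → lookup (A ∩ B) j ∨ lookup ⁅ a ⁆ j) → B ≐ (λ j → lookup (A ∩ B) j ∨ lookup ⁅ b ⁆ j) → ⊥
  overlap-three-cases n≥12 conn x≢y weakly-x weakly-y quad-x quad-y ∣T∣≡3 ∣A∪B∣≡5 ∣B∪A∣≡5 {a} {b} a∉B b∉A A≐ B≐
    with b ≟ x | a ≟ y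
  ... | no b≢x   | _        = OverlapThree.overlap-impossible G {T = A ∩ B} x≢y b≢x a∉B b∉A A≐ B≐ ∣T∣≡3 ∣A∪B∣≡5
                                quad-x quad-y n≥12 weakly-x
  ... | yes refl | no a≢y   = OverlapThree.overlap-impossible G {T = A ∩ B} (x≢y ∘ sym) a≢y b∉A a∉B B≐ A≐ ∣T∣≡3 ∣B∪A∣≡5
                                quad-y quad-x n≥12 weakly-y
  ... | yes refl | yes refl = CrossedOverlap.crossed-overlap-impossible G {T = A ∩ B} x≢y A≐ B≐ ∣T∣≡3 ∣A∪B∣≡5
                                quad-x quad-y n≥12 conn

  overlap-three-impossible : 12 ≤ n → RankConnected 3 G ⊤ → x ≢ y →
    WeaklyThreeRankConnected G (⊤ - x) → WeaklyThreeRankConnected G (⊤ - y) →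
    Quad G (⊤ - x) A → Quad G (⊤ - y) B → ∣ A ∩ B ∣ ≡ 3 → ⊥
  overlap-three-impossible n≥12 conn x≢y weakly-x weakly-y quad-x@(_ , ∣A∣≡4 , _) quad-y@(_ , ∣B∣≡4 , _) ∣A∩B∣≡3
    with single-difference (∣p─q∣≡ A B ∣A∣≡4 ∣A∩B∣≡3 refl) | single-difference (∣p─q∣≡ B A ∣B∣≡4 (trans (∣p∩q∣≡∣q∩p∣ B A) ∣A∩B∣≡3) refl)
  ... | a , _ , a∉B , A≐ | b , _ , b∉A , B≐ =
    overlap-three-cases n≥12 conn x≢y weakly-x weakly-y quad-x quad-y ∣A∩B∣≡3
      (∣p∪q∣≡ A B ∣A∣≡4 ∣B∣≡4 ∣A∩B∣≡3 refl) (∣p∪q∣≡ B A ∣B∣≡4 ∣A∣≡4 (trans (∣p∩q∣≡∣q∩p∣ B A) ∣A∩B∣≡3) refl) a∉B b∉A A≐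
      (subst (λ T → B ≐ λ j → lookup T j ∨ lookup ⁅ b ⁆ j) (SubsetP.∩-comm B A) B≐)

lemma4p11 : (n : ℕ) (G : Graph n) (x y : Fin n) (A B : Subset n) →
    12 ≤ n → RankConnected 3 G ⊤ → x ≢ y →
    WeaklyThreeRankConnected G (⊤ - x) → WeaklyThreeRankConnected G (⊤ - y) →
    Quad G (⊤ - x) A → Quad G (⊤ - y) B →
    ∣ A ∩ B ∣ ≤ 2
lemma4p11 n G x y A B n≥12 conn x≢y weakly-x weakly-y quad-x@(_ , ∣A∣≡4 , _) quad-y@(_ , ∣B∣≡4 , _)
  with ∣ A ∩ B ∣ in ∣A∩B∣≡k | SubsetP.∣p∩q∣≤∣p∣ A B
... | 0 | _ = z≤n
... | 1 | _ = s≤s z≤n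
... | 2 | _ = s≤s (s≤s z≤n)
... | 3 | _ = ⊥-elim (overlap-three-impossible G n≥12 conn x≢y weakly-x weakly-y quad-x quad-y ∣A∩B∣≡k)
... | 4 | _ = ⊥-elim (EqualQuads.equal-quads-impossible G x≢y quad-x (subst (Quad G (⊤ - y)) (sym A≡B) quad-y)
                      n≥12 conn weakly-y)
  where
  A≡B : A ≡ B
  A≡B = ∣p∩q∣≡∣p∣≡∣q∣⇒p≡q (trans ∣A∩B∣≡k (sym ∣A∣≡4)) (trans ∣A∩B∣≡k (sym ∣B∣≡4))
... | suc (suc (suc (suc (suc _)))) | ∣A∩B∣≤∣A∣ with ℕP.≤-trans ∣A∩B∣≤∣A∣ (ℕP.≤-reflexive ∣A∣≡4)
...   | s≤s (s≤s (s≤s (s≤s ())))
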